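{- If $A$ is a $\perp$-type and $A\subseteq B$, then $B$ is a $\perp$-type.
   Context: Formulas. Second-order language with individual variables, function symbols (building terms), predicate symbols and predicate variables of every arity, logical symbols $\perp,\rightarrow,\forall,\mu$. Formulas: $\perp$; atomic $X(t_1,\dots,t_n)$; $A\rightarrow B$; $\forall xA$; $\forall XA$; $\mu Cx_1\dots x_nA\langle t_1,\dots,t_n\rangle$ with $C$ an $n$-ary predicate symbol appearing and positive in $A$ ($C,\bar x$ bound). Positivity of $X$ in $A$: not appearing: both; in $X(\bar t)$: positive only; in $B\rightarrow C$: positive (negative) iff negative (positive) in $B$ and positive (negative) in $C$; in $\forall vB$ ($v\ne X$) and $\mu C\bar xB\langle\bar t\rangle$: as in $B$. $A[G/X(x_1,\dots,x_n)]$ replaces each $X(t_1,\dots,t_n)$ by $G[t_1/x_1,\dots,t_n/x_n]$. Relation $\subseteq$ (fixed set $\mathbf E$ of equations between terms; a particular case of an equation of $\mathbf E$ is $u=v$ or $v=u$ with $u,v$ obtained from the two sides of an equation of $\mathbf E$ by one substitution of terms for individual variables): the least relation closed under (ax) $A\subseteq A$; from $A\subseteq A'$, $B\subseteq B'$ infer $A'\rightarrow B\subseteq A\rightarrow B'$; from $A[G/v]\subseteq B$ infer $\forall vA\subseteq B$ ($G$ a term if $v$ is an individual variable, a formula if $v$ is a predicate variable); from $A\subseteq B$ infer $A\subseteq\forall vB$ if $v$ not free in $A$; from $A\subseteq B[u/y]$ infer $A\subseteq B[w/y]$ if $u=w$ is a particular case of an equation of $\mathbf E$; from $A\subseteq D$,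 $D\subseteq B$ infer $A\subseteq B$; ($\mu_d$) $D[\mu Cx_1\dots x_mD\langle z_1,\dots,z_m\rangle/C(z_1,\dots,z_m)][t_1/x_1,\dots,t_m/x_m]\subseteq\mu Cx_1\dots x_mD\langle t_1,\dots,t_m\rangle$; ($\mu'_g$) the converse; ($\mu_g$) from $D[F/C(x_1,\dots,x_m)]\subseteq F$ infer $\mu Cx_1\dots x_mD\langle t_1,\dots,t_m\rangle\subseteq F[t_1/x_1,\dots,t_m/x_m]$. $\perp$-types: least set containing $\perp$ and containing $B\rightarrow A$ (any $B$), $\forall vA$ (any variable $v$) and $\mu Cx_1\dots x_nA\langle t_1,\dots,t_n\rangle$ ($C$ appearing and positive in $A$) whenever it contains $A$. -}

module Defs where

open import Data.Nat using (ℕ; zero; suc; _+_; _*_)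
open import Data.Fin using (Fin; toℕ)
open import Data.Vec using (Vec; []; _∷_; tabulate)
open import Data.List using (List; []; _∷_)
open import Relation.Nullary using (¬_)

-- Predicate VARIABLES (and the predicate symbols bound by μ)
-- are handled by de Bruijn indices into a context of arities.

record Sig : Set₁ where
  field
    FSym   : Set
    farity : FSym → ℕ
    PSym   : Set
    parity : PSym → ℕ
open Sig public

-- Terms (individual variables are de Bruijn indices)

data Term (S : Sig) : Set where
  var : ℕ → Term S
  fn  : (f : FSym S) → Vec (Term S) (farity S f) → Term S

data PVar : List ℕ → ℕ → Set where
  pz : ∀ {Γ n} → PVar (n ∷ Γ) n
  ps : ∀ {Γ n k} → PVar Γ n → PVar (k ∷ Γ) n

-- Form S Γ : formulas whose free predicate variables are in Γ.
--   ∀i A        : ∀x A           (x = individual de Bruijn index 0)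
--   ∀p n A      : ∀X A           (X an n-ary predicate variable, index pz)
--   μ m D ts    : μ C x₁…xₘ D ⟨t₁,…,tₘ⟩ ; in D, C is pz and x_{i+1} is
--                 individual index i (i < m); outer variables shifted by m.

data Form (S : Sig) : List ℕ → Set where
  ⊥'  : ∀ {Γ} → Form S Γ
  pv  : ∀ {Γ n} → PVar Γ n → Vec (Term S) n → Form S Γ
  psy : ∀ {Γ} (p : PSym S) → Vec (Term S) (parity S p) → Form S Γ
  _⇒_ : ∀ {Γ} → Form S Γ → Form S Γ → Form S Γ
  ∀i  : ∀ {Γ} → Form S Γ → Form S Γ
  ∀p  : ∀ {Γ} (n : ℕ) → Form S (n ∷ Γ) → Form S Γ
  μ   : ∀ {Γ} (m : ℕ) → Form S (m ∷ Γ) → Vec (Term S) m → Form S Γ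

infixr 5 _⇒_

module _ {S : Sig} where

  Subst : Set
  Subst = ℕ → Term S

  mutual
    tsub : Subst → Term S → Term S
    tsub σ (var i)   = σ i
    tsub σ (fn f ts) = fn f (tsubs σ ts)

    tsubs : ∀ {n} → Subst → Vec (Term S) n → Vec (Term S) n
    tsubs σ []       = []
    tsubs σ (t ∷ ts) = tsub σ t ∷ tsubs σ ts

  shift : ℕ → Subst
  shift k i = var (k + i)

  exts : Subst → Subst
  exts σ zero    = var zero
  exts σ (suc i) = tsub (shift 1) (σ i)

  extsN : ℕ → Subst → Subst
  extsN zero    σ = σ
  extsN (suc m) σ = exts (extsN m σ)

  _∷ₛ_ : Term S → Subst → Subst
  (t ∷ₛ σ) zero    = t
  (t ∷ₛ σ) (suc i) = σ i

  inst : ∀ {n} → Vec (Term S) n → Subst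
  inst []       = var
  inst (t ∷ ts) = t ∷ₛ inst ts

  vars : (n : ℕ) → Vec (Term S) n
  vars n = tabulate (λ i → var (toℕ i))

  isub : ∀ {Γ} → Subst → Form S Γ → Form S Γ
  isub σ ⊥'         = ⊥'
  isub σ (pv X ts)  = pv X (tsubs σ ts)
  isub σ (psy p ts) = psy p (tsubs σ ts)
  isub σ (A ⇒ B)    = isub σ A ⇒ isub σ B
  isub σ (∀i A)     = ∀i (isub (exts σ) A)
  isub σ (∀p n A)   = ∀p n (isub σ A)
  isub σ (μ m D ts) = μ m (isub (extsN m σ) D) (tsubs σ ts)

  isub0 : ∀ {Γ} → Term S → Form S Γ → Form S Γ
  isub0 t A = isub (t ∷ₛ var) A

  PRen : List ℕ → List ℕ → Set
  PRen Γ Δ = ∀ {n} → PVar Γ n → PVar Δ n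

  pliftR : ∀ {Γ Δ k} → PRen Γ Δ → PRen (k ∷ Γ) (k ∷ Δ)
  pliftR ρ pz     = pz
  pliftR ρ (ps X) = ps (ρ X)

  pren : ∀ {Γ Δ} → PRen Γ Δ → Form S Γ → Form S Δ
  pren ρ ⊥'         = ⊥'
  pren ρ (pv X ts)  = pv (ρ X) ts
  pren ρ (psy p ts) = psy p ts
  pren ρ (A ⇒ B)    = pren ρ A ⇒ pren ρ B
  pren ρ (∀i A)     = ∀i (pren ρ A)
  pren ρ (∀p n A)   = ∀p n (pren (pliftR ρ) A)
  pren ρ (μ m D ts) = μ m (pren (pliftR ρ) D) ts

  pweak : ∀ {Γ k} → Form S Γ → Form S (k ∷ Γ)
  pweak = pren ps

  -- The image of an n-ary variable is an "abstraction": a formula whose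
  -- individual indices 0 … n-1 are the parameters x₁ … xₙ and whose
  -- indices n + j denote variable j of the ambient scope.
  PSub : List ℕ → List ℕ → Set
  PSub Γ Δ = ∀ {n} → PVar Γ n → Form S Δ

  _↑i : ∀ {Γ Δ} → PSub Γ Δ → PSub Γ Δ
  (σ ↑i) {n} X = isub (extsN n (shift 1)) (σ X)

  _↑iN_ : ∀ {Γ Δ} → PSub Γ Δ → ℕ → PSub Γ Δ
  σ ↑iN zero    = σ
  σ ↑iN (suc m) = (σ ↑iN m) ↑i

  _↑p : ∀ {Γ Δ k} → PSub Γ Δ → PSub (k ∷ Γ) (k ∷ Δ)
  (σ ↑p) {n} pz = pv pz (vars n)
  (σ ↑p) (ps X) = pweak (σ X)

  psub : ∀ {Γ Δ} → PSub Γ Δ → Form S Γ → Form S Δ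
  psub σ ⊥'         = ⊥'
  psub σ (pv X ts)  = isub (inst ts) (σ X)
  psub σ (psy p ts) = psy p ts
  psub σ (A ⇒ B)    = psub σ A ⇒ psub σ B
  psub σ (∀i A)     = ∀i (psub (σ ↑i) A)
  psub σ (∀p n A)   = ∀p n (psub (σ ↑p) A)
  psub σ (μ m D ts) = μ m (psub ((σ ↑iN m) ↑p) D) ts

  pid : ∀ {Γ} → PSub Γ Γ
  pid {n = n} X = pv X (vars n)

  psub0 : ∀ {Γ n} → Form S Γ → Form S (n ∷ Γ) → Form S Γ
  psub0 {Γ} {n} G A = psub σ A
    where
      σ : PSub (n ∷ Γ) Γ
      σ pz     = G
      σ (ps X) = pid X

  data Appears : ∀ {Γ k} → PVar Γ k → Form S Γ → Set where
    ap-pv : ∀ {Γ k} {X : PVar Γ k} {ts} → Appears X (pv X ts)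
    ap-⇒l : ∀ {Γ k} {X : PVar Γ k} {A B} → Appears X A → Appears X (A ⇒ B)
    ap-⇒r : ∀ {Γ k} {X : PVar Γ k} {A B} → Appears X B → Appears X (A ⇒ B)
    ap-∀i : ∀ {Γ k} {X : PVar Γ k} {A} → Appears X A → Appears X (∀i A)
    ap-∀p : ∀ {Γ k n} {X : PVar Γ k} {A} → Appears (ps X) A → Appears X (∀p n A)
    ap-μ  : ∀ {Γ k m} {X : PVar Γ k} {D ts} → Appears (ps X) D → Appears X (μ m D ts)

  mutual
    data Positive : ∀ {Γ k} → PVar Γ k → Form S Γ → Set where
      po-⊥  : ∀ {Γ k} {X : PVar Γ k} → Positive X ⊥'
      po-pv : ∀ {Γ k n} {X : PVar Γ k} {Y : PVar Γ n} {ts} → Positive X (pv Y ts)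
      po-ps : ∀ {Γ k} {X : PVar Γ k} {p ts} → Positive X (psy p ts)
      po-⇒  : ∀ {Γ k} {X : PVar Γ k} {A B} → Negative X A → Positive X B → Positive X (A ⇒ B)
      po-∀i : ∀ {Γ k} {X : PVar Γ k} {A} → Positive X A → Positive X (∀i A)
      po-∀p : ∀ {Γ k n} {X : PVar Γ k} {A} → Positive (ps X) A → Positive X (∀p n A)
      po-μ  : ∀ {Γ k m} {X : PVar Γ k} {D ts} → Positive (ps X) D → Positive X (μ m D ts)

    data Negative : ∀ {Γ k} → PVar Γ k → Form S Γ → Set where
      ne-⊥  : ∀ {Γ k} {X : PVar Γ k} → Negative X ⊥'
      ne-pv : ∀ {Γ k n} {X : PVar Γ k} {Y : PVar Γ n} {ts} → ¬ Appears X (pv Y ts) → Negative X (pv Y ts)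
      ne-ps : ∀ {Γ k} {X : PVar Γ k} {p ts} → Negative X (psy p ts)
      ne-⇒  : ∀ {Γ k} {X : PVar Γ k} {A B} → Positive X A → Negative X B → Negative X (A ⇒ B)
      ne-∀i : ∀ {Γ k} {X : PVar Γ k} {A} → Negative X A → Negative X (∀i A)
      ne-∀p : ∀ {Γ k n} {X : PVar Γ k} {A} → Negative (ps X) A → Negative X (∀p n A)
      ne-μ  : ∀ {Γ k m} {X : PVar Γ k} {D ts} → Negative (ps X) D → Negative X (μ m D ts)

  data WF : ∀ {Γ} → Form S Γ → Set where
    wf-⊥  : ∀ {Γ} → WF {Γ} ⊥'
    wf-pv : ∀ {Γ n} {X : PVar Γ n} {ts} → WF (pv X ts)
    wf-ps : ∀ {Γ p ts} → WF {Γ} (psy p ts)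
    wf-⇒  : ∀ {Γ} {A B : Form S Γ} → WF A → WF B → WF (A ⇒ B)
    wf-∀i : ∀ {Γ} {A : Form S Γ} → WF A → WF (∀i A)
    wf-∀p : ∀ {Γ n} {A : Form S (n ∷ Γ)} → WF A → WF (∀p n A)
    wf-μ  : ∀ {Γ m} {D : Form S (m ∷ Γ)} {ts} →
            Appears pz D → Positive pz D → WF D → WF (μ m D ts)

  data BotType : ∀ {Γ} → Form S Γ → Set where
    bt-⊥  : ∀ {Γ} → BotType {Γ} ⊥'
    bt-⇒  : ∀ {Γ} {A : Form S Γ} (B : Form S Γ) → BotType A → BotType (B ⇒ A)
    bt-∀i : ∀ {Γ} {A : Form S Γ} → BotType A → BotType (∀i A)
    bt-∀p : ∀ {Γ n} {A : Form S (n ∷ Γ)} → BotType A → BotType (∀p n A)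
    bt-μ  : ∀ {Γ m} {A : Form S (m ∷ Γ)} {ts} →
            Appears pz A → Positive pz A → BotType A → BotType (μ m A ts)

  Eqns : Set₁
  Eqns = Term S → Term S → Set

  data PartCase (E : Eqns) : Term S → Term S → Set where
    pc-→ : ∀ {u v} → E u v → (σ : Subst) → PartCase E (tsub σ u) (tsub σ v)
    pc-← : ∀ {u v} → E u v → (σ : Subst) → PartCase E (tsub σ v) (tsub σ u)

  -- The relation ⊆ (all formulas involved are well-formed: each rule
  -- requires well-formedness of both sides of its conclusion; premises
  -- are derivations and hence well-formed by induction).

  data _⊢_⊆_ (E : Eqns) : ∀ {Γ} → Form S Γ → Form S Γ → Set where
    ax   : ∀ {Γ} {A : Form S Γ} → WF A → E ⊢ A ⊆ A
    arr  : ∀ {Γ} {A A' B B' : Form S Γ} → WF (A' ⇒ B) → WF (A ⇒ B') →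
           E ⊢ A ⊆ A' → E ⊢ B ⊆ B' → E ⊢ (A' ⇒ B) ⊆ (A ⇒ B')
    ∀iL  : ∀ {Γ} {A B : Form S Γ} (t : Term S) → WF (∀i A) → WF B →
           E ⊢ isub0 t A ⊆ B → E ⊢ ∀i A ⊆ B
    ∀pL  : ∀ {Γ n} {A : Form S (n ∷ Γ)} {B : Form S Γ} (G : Form S Γ) →
           WF (∀p n A) → WF B →
           E ⊢ psub0 G A ⊆ B → E ⊢ ∀p n A ⊆ B
    ∀iR  : ∀ {Γ} {A B : Form S Γ} → WF A → WF (∀i B) →
           E ⊢ isub (shift 1) A ⊆ B → E ⊢ A ⊆ ∀i B
    ∀pR  : ∀ {Γ n} {A : Form S Γ} {B : Form S (n ∷ Γ)} → WF A → WF (∀p n B) →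
           E ⊢ pweak A ⊆ B → E ⊢ A ⊆ ∀p n B
    eqn  : ∀ {Γ} {A B : Form S Γ} {u w : Term S} → PartCase E u w →
           WF A → WF (isub0 w B) →
           E ⊢ A ⊆ isub0 u B → E ⊢ A ⊆ isub0 w B
    trans : ∀ {Γ} {A B : Form S Γ} (D : Form S Γ) → WF A → WF B →
           E ⊢ A ⊆ D → E ⊢ D ⊆ B → E ⊢ A ⊆ B
    μd   : ∀ {Γ m} {D : Form S (m ∷ Γ)} {ts : Vec (Term S) m} →
           WF (isub (inst ts) (psub0 (μ m (isub (extsN m (shift (m + m))) D) (vars m)) D)) →
           WF (μ m D ts) →
           E ⊢ isub (inst ts) (psub0 (μ m (isub (extsN m (shift (m + m))) D) (vars m)) D)
             ⊆ μ m D ts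
    μg'  : ∀ {Γ m} {D : Form S (m ∷ Γ)} {ts : Vec (Term S) m} →
           WF (μ m D ts) →
           WF (isub (inst ts) (psub0 (μ m (isub (extsN m (shift (m + m))) D) (vars m)) D)) →
           E ⊢ μ m D ts
             ⊆ isub (inst ts) (psub0 (μ m (isub (extsN m (shift (m + m))) D) (vars m)) D)
    μg   : ∀ {Γ m} {D : Form S (m ∷ Γ)} {F : Form S Γ} {ts : Vec (Term S) m} →
           WF (μ m D ts) → WF (isub (inst ts) F) →
           E ⊢ psub0 (isub (extsN m (shift m)) F) D ⊆ F →
           E ⊢ μ m D ts ⊆ isub (inst ts) F

module Submission where

-- A ⊥-type is a formula whose "spine" — followed through the conclusions of
-- implications and the bodies of ∀x, ∀X and μ — ends in ⊥, together with the
-- side conditions (C appears and is positive) at every μ on the spine.  We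
-- separate the two parts: BotShape records only the spine, and a formula is a
-- ⊥-type iff it is ⊥-shaped and well formed.  Since every derivation of
-- A ⊆ B has a well-formed right-hand side, the theorem reduces to showing that
-- ⊆ preserves ⊥-shape.  This is proved by induction on the derivation; the
-- rules that substitute terms or formulas need that substitution preserves
-- ⊥-shape, and the rules that go from a substitution instance back to its
-- pattern (the equation rule, and μd) need the converse direction: a ⊥-shaped
-- instance of A comes from a ⊥-shaped A or from a ⊥-shaped substituted
-- formula.  For μd the substituted formula is a μ around a copy of D, so in
-- both cases D itself is ⊥-shaped.

open import Defs
open import Data.Nat using (ℕ; zero; suc; _+_)
open import Data.Vec using (Vec)
open import Data.List using (_∷_)
open import Data.Product using (∃₂; _,_)
open import Data.Sum using (_⊎_; inj₁; inj₂) renaming (map to ⊎-map; map₁ to ⊎-map₁)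
open import Function using (_∘_; id)

module _ {S : Sig} where

  data BotShape : ∀ {Γ} → Form S Γ → Set where
    bs-⊥  : ∀ {Γ} → BotShape {Γ} ⊥'
    bs-⇒  : ∀ {Γ} {A : Form S Γ} (B : Form S Γ) → BotShape A → BotShape (B ⇒ A)
    bs-∀i : ∀ {Γ} {A : Form S Γ} → BotShape A → BotShape (∀i A)
    bs-∀p : ∀ {Γ n} {A : Form S (n ∷ Γ)} → BotShape A → BotShape (∀p n A)
    bs-μ  : ∀ {Γ m} {A : Form S (m ∷ Γ)} {ts} → BotShape A → BotShape (μ m A ts)

  botType⇒shape : ∀ {Γ} {A : Form S Γ} → BotType A → BotShape A
  botType⇒shape bt-⊥         = bs-⊥
  botType⇒shape (bt-⇒ B a)   = bs-⇒ B (botType⇒shape a)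
  botType⇒shape (bt-∀i a)    = bs-∀i (botType⇒shape a)
  botType⇒shape (bt-∀p a)    = bs-∀p (botType⇒shape a)
  botType⇒shape (bt-μ _ _ a) = bs-μ (botType⇒shape a)

  shape⇒botType : ∀ {Γ} {A : Form S Γ} → BotShape A → WF A → BotType A
  shape⇒botType bs-⊥       _                  = bt-⊥
  shape⇒botType (bs-⇒ B a) (wf-⇒ _ wA)        = bt-⇒ B (shape⇒botType a wA)
  shape⇒botType (bs-∀i a)  (wf-∀i wA)         = bt-∀i (shape⇒botType a wA)
  shape⇒botType (bs-∀p a)  (wf-∀p wA)         = bt-∀p (shape⇒botType a wA)
  shape⇒botType (bs-μ a)   (wf-μ app pos wA)  = bt-μ app pos (shape⇒botType a wA)

  isub-shape : ∀ {Γ} (σ : Subst) {A : Form S Γ} → BotShape A → BotShape (isub σ A)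
  isub-shape σ bs-⊥       = bs-⊥
  isub-shape σ (bs-⇒ _ a) = bs-⇒ _ (isub-shape σ a)
  isub-shape σ (bs-∀i a)  = bs-∀i (isub-shape (exts σ) a)
  isub-shape σ (bs-∀p a)  = bs-∀p (isub-shape σ a)
  isub-shape σ (bs-μ a)   = bs-μ (isub-shape _ a)

  isub-shape⁻ : ∀ {Γ} (σ : Subst) (A : Form S Γ) → BotShape (isub σ A) → BotShape A
  isub-shape⁻ σ ⊥'         _          = bs-⊥
  isub-shape⁻ σ (pv X ts)  ()
  isub-shape⁻ σ (psy p ts) ()
  isub-shape⁻ σ (A ⇒ B)    (bs-⇒ _ b) = bs-⇒ A (isub-shape⁻ σ B b)
  isub-shape⁻ σ (∀i A)     (bs-∀i a)  = bs-∀i (isub-shape⁻ (exts σ) A a)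
  isub-shape⁻ σ (∀p n A)   (bs-∀p a)  = bs-∀p (isub-shape⁻ σ A a)
  isub-shape⁻ σ (μ m A ts) (bs-μ a)   = bs-μ (isub-shape⁻ _ A a)

  pren-shape : ∀ {Γ Δ} (ρ : PRen {S} Γ Δ) {A : Form S Γ} → BotShape A → BotShape (pren ρ A)
  pren-shape ρ bs-⊥       = bs-⊥
  pren-shape ρ (bs-⇒ _ a) = bs-⇒ _ (pren-shape ρ a)
  pren-shape ρ (bs-∀i a)  = bs-∀i (pren-shape ρ a)
  pren-shape ρ (bs-∀p a)  = bs-∀p (pren-shape (pliftR ρ) a)
  pren-shape ρ (bs-μ a)   = bs-μ (pren-shape (pliftR ρ) a)

  pren-shape⁻ : ∀ {Γ Δ} (ρ : PRen {S} Γ Δ) (A : Form S Γ) → BotShape (pren ρ A) → BotShape A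
  pren-shape⁻ ρ ⊥'         _          = bs-⊥
  pren-shape⁻ ρ (pv X ts)  ()
  pren-shape⁻ ρ (psy p ts) ()
  pren-shape⁻ ρ (A ⇒ B)    (bs-⇒ _ b) = bs-⇒ A (pren-shape⁻ ρ B b)
  pren-shape⁻ ρ (∀i A)     (bs-∀i a)  = bs-∀i (pren-shape⁻ ρ A a)
  pren-shape⁻ ρ (∀p n A)   (bs-∀p a)  = bs-∀p (pren-shape⁻ (pliftR ρ) A a)
  pren-shape⁻ ρ (μ m A ts) (bs-μ a)   = bs-μ (pren-shape⁻ (pliftR ρ) A a)

  -- A ⊥-shaped formula stays ⊥-shaped under any substitution of formulas for
  -- predicate variables: the spine never passes through a predicate variable.
  psub-shape : ∀ {Γ Δ} (σ : PSub Γ Δ) {A : Form S Γ} → BotShape A → BotShape (psub σ A)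
  psub-shape σ bs-⊥       = bs-⊥
  psub-shape σ (bs-⇒ _ a) = bs-⇒ _ (psub-shape σ a)
  psub-shape σ (bs-∀i a)  = bs-∀i (psub-shape (σ ↑i) a)
  psub-shape σ (bs-∀p a)  = bs-∀p (psub-shape (σ ↑p) a)
  psub-shape σ (bs-μ a)   = bs-μ (psub-shape _ a)

  ShapedImage : ∀ {Γ Δ} → PSub Γ Δ → Set
  ShapedImage {Γ} σ = ∃₂ λ n (X : PVar Γ n) → BotShape (σ X)

  -- Lifting a substitution under binders creates no new ⊥-shaped images:
  -- images are only shifted, and a freshly bound variable maps to itself.
  shapedImage-↑i : ∀ {Γ Δ} (σ : PSub Γ Δ) → ShapedImage (σ ↑i) → ShapedImage σ
  shapedImage-↑i σ (n , X , b) = n , X , isub-shape⁻ _ (σ X) b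

  shapedImage-↑iN : ∀ {Γ Δ} (σ : PSub Γ Δ) (m : ℕ) → ShapedImage (σ ↑iN m) → ShapedImage σ
  shapedImage-↑iN σ zero    = id
  shapedImage-↑iN σ (suc m) = shapedImage-↑iN σ m ∘ shapedImage-↑i (σ ↑iN m)

  shapedImage-↑p : ∀ {Γ Δ k} (σ : PSub Γ Δ) → ShapedImage (_↑p {k = k} σ) → ShapedImage σ
  shapedImage-↑p σ (_ , pz   , ())
  shapedImage-↑p σ (n , ps X , b) = n , X , pren-shape⁻ ps (σ X) b

  -- Converse of psub-shape: the spine of A[σ] either stays inside A, or it
  -- reaches an occurrence X(t̄) in A and continues inside σ X.
  psub-shape⁻ : ∀ {Γ Δ} (σ : PSub Γ Δ) (A : Form S Γ) →
                BotShape (psub σ A) → BotShape A ⊎ ShapedImage σ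
  psub-shape⁻ σ ⊥'         _          = inj₁ bs-⊥
  psub-shape⁻ σ (pv X ts)  b          = inj₂ (_ , X , isub-shape⁻ (inst ts) (σ X) b)
  psub-shape⁻ σ (psy p ts) ()
  psub-shape⁻ σ (A ⇒ B)    (bs-⇒ _ b) = ⊎-map₁ (bs-⇒ A) (psub-shape⁻ σ B b)
  psub-shape⁻ σ (∀i A)     (bs-∀i a)  =
    ⊎-map bs-∀i (shapedImage-↑i σ) (psub-shape⁻ (σ ↑i) A a)
  psub-shape⁻ σ (∀p n A)   (bs-∀p a)  =
    ⊎-map bs-∀p (shapedImage-↑p σ) (psub-shape⁻ (σ ↑p) A a)
  psub-shape⁻ σ (μ m A ts) (bs-μ a)   =
    ⊎-map bs-μ (shapedImage-↑iN σ m ∘ shapedImage-↑p (σ ↑iN m))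
               (psub-shape⁻ ((σ ↑iN m) ↑p) A a)

  -- The unfolding D[μ C x̄ D ⟨z̄⟩ / C(z̄)][t̄/x̄] of μ C x̄ D ⟨t̄⟩ (rules μd, μg').
  unfold : ∀ {Γ} (m : ℕ) → Form S (m ∷ Γ) → Vec (Term S) m → Form S Γ
  unfold m D ts = isub (inst ts) (psub0 (μ m (isub (extsN m (shift (m + m))) D) (vars m)) D)

  -- If the unfolding is ⊥-shaped then so is D: the only substituted formula
  -- is μ C x̄ D' with D' a renaming of D.
  unfold-shape⁻ : ∀ {Γ m} (D : Form S (m ∷ Γ)) (ts : Vec (Term S) m) →
                  BotShape (unfold m D ts) → BotShape D
  unfold-shape⁻ D ts b with psub-shape⁻ _ D (isub-shape⁻ (inst ts) _ b)
  ... | inj₁ d                    = d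
  ... | inj₂ (_ , pz   , bs-μ d)  = isub-shape⁻ _ D d
  ... | inj₂ (_ , ps X , ())

  ⊆-shape : ∀ {E : Eqns} {Γ} {A B : Form S Γ} → BotShape A → E ⊢ A ⊆ B → BotShape B
  ⊆-shape a          (ax _)                      = a
  ⊆-shape (bs-⇒ _ a) (arr _ _ _ q)               = bs-⇒ _ (⊆-shape a q)
  ⊆-shape (bs-∀i a)  (∀iL _ _ _ q)               = ⊆-shape (isub-shape _ a) q
  ⊆-shape (bs-∀p a)  (∀pL _ _ _ q)               = ⊆-shape (psub-shape _ a) q
  ⊆-shape a          (∀iR _ _ q)                 = bs-∀i (⊆-shape (isub-shape _ a) q)
  ⊆-shape a          (∀pR _ _ q)                 = bs-∀p (⊆-shape (pren-shape ps a) q)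
  ⊆-shape a          (eqn {B = B} _ _ _ q)       = isub-shape _ (isub-shape⁻ _ B (⊆-shape a q))
  ⊆-shape a          (trans _ _ _ p q)           = ⊆-shape (⊆-shape a p) q
  ⊆-shape a          (μd {D = D} {ts = ts} _ _)  = bs-μ (unfold-shape⁻ D ts a)
  ⊆-shape (bs-μ a)   (μg' _ _)                   = isub-shape _ (psub-shape _ a)
  ⊆-shape (bs-μ a)   (μg _ _ q)                  = isub-shape _ (⊆-shape (psub-shape _ a) q)

  ⊆-wfʳ : ∀ {E : Eqns} {Γ} {A B : Form S Γ} → E ⊢ A ⊆ B → WF B
  ⊆-wfʳ (ax w)              = w
  ⊆-wfʳ (arr _ w _ _)       = w
  ⊆-wfʳ (∀iL _ _ w _)       = w
  ⊆-wfʳ (∀pL _ _ w _)       = w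
  ⊆-wfʳ (∀iR _ w _)         = w
  ⊆-wfʳ (∀pR _ w _)         = w
  ⊆-wfʳ (eqn _ _ w _)       = w
  ⊆-wfʳ (trans _ _ w _ _)   = w
  ⊆-wfʳ (μd _ w)            = w
  ⊆-wfʳ (μg' _ w)           = w
  ⊆-wfʳ (μg _ w _)          = w

lemma6p1 : {S : Sig} (E : Eqns {S}) {Γ : _} {A B : Form S Γ} →
    BotType A → E ⊢ A ⊆ B → BotType B
lemma6p1 E a q = shape⇒botType (⊆-shape (botType⇒shape a) q) (⊆-wfʳ q)
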